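{- For all integers $k \ge 1$ and $1 \le j \le k$, $P_j(Q_k) \ge k - 1$.
   Context: $Q_k$ is the $k$-dimensional hypercube: vertex set $\{0,1\}^k$, two vertices adjacent iff they differ in exactly one coordinate. For integer $t \ge 1$, $P_t(Q_k)$ denotes the maximum integer $\ell$ such that there is a vertex $v$ of $Q_k$ and $t$ paths in $Q_k$, each of length $\ell$ (i.e. $\ell$ edges) and starting at $v$, pairwise sharing no vertex other than $v$. -}

module Defs where

open import Data.Nat using (ℕ; zero; suc; _+_)
open import Data.Bool using (Bool; true; false; _xor_)
open import Data.Vec using (Vec; []; _∷_)
open import Data.Fin using (Fin; zero; suc; inject₁)
open import Data.Product using (Σ; _×_)
open import Relation.Binary.PropositionalEquality using (_≡_)
open import Relation.Nullary using (¬_)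
open import Function.Definitions using (Injective)

Vertex : ℕ → Set
Vertex k = Vec Bool k

hamming : ∀ {k} → Vertex k → Vertex k → ℕ
hamming [] [] = 0
hamming (x ∷ xs) (y ∷ ys) with x xor y
... | true  = suc (hamming xs ys)
... | false = hamming xs ys

Adj : ∀ {k} → Vertex k → Vertex k → Set
Adj u w = hamming u w ≡ 1

record Path (k ℓ : ℕ) : Set where
  field
    vtx      : Fin (suc ℓ) → Vertex k
    adjacent : (i : Fin ℓ) → Adj (vtx (inject₁ i)) (vtx (suc i))
    distinct : Injective _≡_ _≡_ vtx
open Path public

start : ∀ {k ℓ} → Path k ℓ → Vertex k
start p = vtx p zero

DisjointPathsFrom : (k t ℓ : ℕ) → Set
DisjointPathsFrom k t ℓ =
  Σ (Vertex k) λ v →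
  Σ (Fin t → Path k ℓ) λ P →
    ((i : Fin t) → start (P i) ≡ v) ×
    ((i j : Fin t) → ¬ (i ≡ j) → (a b : Fin (suc ℓ)) →
        vtx (P i) a ≡ vtx (P j) b → vtx (P i) a ≡ v)

module Submission where

-- Write k = n + 1 and arrange the coordinates 0, …, n on a cycle.  The arc
-- arc i a is the vertex whose true coordinates are the a cyclically
-- consecutive positions i, i+1, …, i+a-1 (mod k).  For a fixed start i the
-- arcs arc i 0, …, arc i n form a path of length n from the all-false vertex:
-- consecutive arcs differ in one coordinate, and arcs of different lengths
-- differ.  Two arcs of positive length < k with different starts i ≠ i'
-- differ: arc i a contains i but not its cyclic predecessor p, whereas every
-- arc from i' that contains i also contains p.  This gives k such paths, and
-- any j ≤ k of them still form a disjoint family.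

open import Defs
open import Data.Nat using (ℕ; _≤_; _∸_)
open import Data.Product using (Σ; _×_)
open import Data.Product using (_,_)
open import Data.Nat using (zero; suc; _+_; _<_; z≤n; z<s; s≤s⁻¹; _≤?_; _<?_)
open import Data.Nat.Properties
open import Data.Bool using (Bool; true; false)
open import Data.Fin using (Fin; zero; suc; toℕ; fromℕ<; inject≤)
open import Data.Fin.Properties using (toℕ-fromℕ<; toℕ-injective; toℕ-inject₁; toℕ<n; inject≤-injective)
  renaming (suc-injective to Fin-suc-injective)
open import Data.Vec using (Vec; []; _∷_; tabulate; lookup)
open import Data.Vec.Properties using (lookup∘tabulate; tabulate-cong)
open import Relation.Nullary using (¬_; Dec; yes; no; does; contradiction)
open import Relation.Nullary.Decidable using (dec-true; dec-false; does-⇔)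
open import Function.Bundles using (mk⇔)
open import Relation.Binary.PropositionalEquality
open import Relation.Binary.Definitions using (tri<; tri≈; tri>)
open import Function using (_∘_)

hamming-cons-≡ : ∀ {m} {x y : Bool} {xs ys : Vec Bool m} →
                 x ≡ y → hamming (x ∷ xs) (y ∷ ys) ≡ hamming xs ys
hamming-cons-≡ {x = false} refl = refl
hamming-cons-≡ {x = true}  refl = refl

hamming-cons-≢ : ∀ {m} {x y : Bool} {xs ys : Vec Bool m} →
                 x ≢ y → hamming (x ∷ xs) (y ∷ ys) ≡ suc (hamming xs ys)
hamming-cons-≢ {x = false} {false} x≢y = contradiction refl x≢y
hamming-cons-≢ {x = false} {true}  _   = refl
hamming-cons-≢ {x = true}  {false} _   = refl
hamming-cons-≢ {x = true}  {true}  x≢y = contradiction refl x≢y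

hamming-self : ∀ {m} (u : Vertex m) → hamming u u ≡ 0
hamming-self []   = refl
hamming-self (x ∷ xs) = trans (hamming-cons-≡ {x = x} refl) (hamming-self xs)

adjacent-tabulate : ∀ {m} (f g : Fin m → Bool) (d : Fin m) →
                    (∀ c → c ≢ d → f c ≡ g c) → f d ≢ g d →
                    Adj (tabulate f) (tabulate g)
adjacent-tabulate f g zero agree differ =
  trans (hamming-cons-≢ differ)
        (cong suc (subst (λ w → hamming (tabulate (f ∘ suc)) w ≡ 0)
                         (tabulate-cong (λ c → agree (suc c) λ ()))
                         (hamming-self (tabulate (f ∘ suc)))))
adjacent-tabulate f g (suc d) agree differ =
  trans (hamming-cons-≡ (agree zero λ ()))
        (adjacent-tabulate (f ∘ suc) (g ∘ suc) d
          (λ c c≢d → agree (suc c) (c≢d ∘ Fin-suc-injective)) differ)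

data OffsetSpec (k i c : ℕ) : ℕ → Set where
  forward : ∀ {x} → i ≤ c → x + i ≡ c     → OffsetSpec k i c x
  wrapped : ∀ {x} → c < i → x + i ≡ k + c → OffsetSpec k i c x

-- offset k i c is the number of forward steps from position i to position c
-- on a cycle of length k (for i, c < k).  It is kept opaque: every later
-- argument uses only its defining equations.
opaque
  offset : ℕ → ℕ → ℕ → ℕ
  offset k i c with i ≤? c
  ... | yes _ = c ∸ i
  ... | no  _ = k + c ∸ i

  offset-spec : ∀ {k} i c → i < k → OffsetSpec k i c (offset k i c)
  offset-spec {k} i c i<k with i ≤? c
  ... | yes i≤c = forward i≤c (m∸n+n≡m i≤c)
  ... | no  i≰c = wrapped (≰⇒> i≰c) (m∸n+n≡m (≤-trans (<⇒≤ i<k) (m≤m+n k c)))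

offset-unique : ∀ {k i c x y} → OffsetSpec k i c x → OffsetSpec k i c y → x ≡ y
offset-unique {i = i} (forward _ e) (forward _ e′) = +-cancelʳ-≡ i _ _ (trans e (sym e′))
offset-unique {i = i} (wrapped _ e) (wrapped _ e′) = +-cancelʳ-≡ i _ _ (trans e (sym e′))
offset-unique (forward i≤c _) (wrapped c<i _) = contradiction i≤c (<⇒≱ c<i)
offset-unique (wrapped c<i _) (forward i≤c _) = contradiction i≤c (<⇒≱ c<i)

offset-≡ : ∀ {k i c x} → i < k → OffsetSpec k i c x → offset k i c ≡ x
offset-≡ {i = i} {c} i<k = offset-unique (offset-spec i c i<k)

offset-self : ∀ {k i} → i < k → offset k i i ≡ 0
offset-self i<k = offset-≡ i<k (forward ≤-refl refl)

offset-spec-injective : ∀ {k i c c′ x} → c < k → c′ < k →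
                        OffsetSpec k i c x → OffsetSpec k i c′ x → c ≡ c′
offset-spec-injective _ _ (forward _ e) (forward _ e′) = trans (sym e) e′
offset-spec-injective {k} _ _ (wrapped _ e) (wrapped _ e′) = +-cancelˡ-≡ k _ _ (trans (sym e) e′)
offset-spec-injective {k} {c′ = c′} c<k _ (forward _ e) (wrapped _ e′) =
  contradiction (subst (k ≤_) (trans (sym e′) e) (m≤m+n k c′)) (<⇒≱ c<k)
offset-spec-injective {k} {c = c} _ c′<k (wrapped _ e) (forward _ e′) =
  contradiction (subst (k ≤_) (trans (sym e) e′) (m≤m+n k c)) (<⇒≱ c′<k)

offset-injective : ∀ {k i c c′} → i < k → c < k → c′ < k →
                   offset k i c ≡ offset k i c′ → c ≡ c′
offset-injective {k} {i} {c} {c′} i<k c<k c′<k e =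
  offset-spec-injective c<k c′<k (offset-spec i c i<k)
    (subst (OffsetSpec k i c′) (sym e) (offset-spec i c′ i<k))

offset-surjective : ∀ {k i x} → i < k → x < k → Σ ℕ λ c → c < k × offset k i c ≡ x
offset-surjective {k} {i} {x} i<k x<k with x + i <? k
... | yes x+i<k = x + i , x+i<k , offset-≡ i<k (forward (m≤n+m i x) refl)
... | no  x+i≮k = x + i ∸ k , <-trans c<i i<k ,
                  offset-≡ i<k (wrapped c<i (sym (m+[n∸m]≡n k≤x+i)))
  where
  k≤x+i : k ≤ x + i
  k≤x+i = ≮⇒≥ x+i≮k
  c<i : x + i ∸ k < i
  c<i = subst (x + i ∸ k <_) (m+n∸m≡n k i) (∸-monoˡ-< (+-monoˡ-< i x<k) k≤x+i)

offset-suc : ∀ {k i c} → i < k → suc c ≢ i → offset k i (suc c) ≡ suc (offset k i c)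
offset-suc {k} {i} {c} i<k c+1≢i with offset-spec i c i<k
... | forward i≤c e = offset-≡ i<k (forward (m≤n⇒m≤1+n i≤c) (cong suc e))
... | wrapped c<i e =
  offset-≡ i<k (wrapped (≤∧≢⇒< c<i c+1≢i) (trans (cong suc e) (sym (+-suc k c))))

offset-wrap : ∀ {n i} → i < suc n → i ≢ 0 → offset (suc n) i 0 ≡ suc (offset (suc n) i n)
offset-wrap {n} {i} i<k i≢0 with offset-spec i n i<k
... | forward _ e   =
  offset-≡ i<k (wrapped (n≢0⇒n>0 i≢0) (trans (cong suc e) (sym (+-identityʳ (suc n)))))
... | wrapped n<i _ = contradiction (s≤s⁻¹ i<k) (<⇒≱ n<i)

record Predecessor (n i : ℕ) : Set where
  field
    position : ℕ
    bounded  : position < suc n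
    last     : offset (suc n) i position ≡ n
    before   : ∀ {i′} → i′ < suc n → i′ ≢ i →
               offset (suc n) i′ i ≡ suc (offset (suc n) i′ position)

predecessor : ∀ n i → i < suc n → Predecessor n i
predecessor n zero _ = record
  { position = n
  ; bounded  = n<1+n n
  ; last     = offset-≡ {suc n} z<s (forward z≤n (+-identityʳ n))
  ; before   = offset-wrap
  }
predecessor n (suc m) m+1<k = record
  { position = m
  ; bounded  = <-trans (n<1+n m) m+1<k
  ; last     = offset-≡ m+1<k (wrapped (n<1+n m) (+-suc n m))
  ; before   = λ i′<k i′≢i → offset-suc i′<k (i′≢i ∘ sym)
  }

does-true : ∀ {A : Set} (a? : Dec A) → does a? ≡ true → A
does-true (yes a) _ = a

does-<-suc : ∀ {x a} → x ≢ a → does (x <? a) ≡ does (x <? suc a)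
does-<-suc {x} {a} x≢a =
  does-⇔ (mk⇔ m<n⇒m<1+n (λ x<a+1 → ≤∧≢⇒< (s≤s⁻¹ x<a+1) x≢a)) (x <? a) (x <? suc a)

module CyclicArcs (n : ℕ) where

  open ≡-Reasoning

  k : ℕ
  k = suc n

  origin : Vertex k
  origin = tabulate λ _ → false

  onArc : ℕ → ℕ → Fin k → Bool
  onArc i a c = does (offset k i (toℕ c) <? a)

  arc : ℕ → ℕ → Vertex k
  arc i a = tabulate (onArc i a)

  arc-at : ∀ i a {c} (c<k : c < k) → lookup (arc i a) (fromℕ< c<k) ≡ does (offset k i c <? a)
  arc-at i a c<k =
    trans (lookup∘tabulate (onArc i a) (fromℕ< c<k))
          (cong (λ c → does (offset k i c <? a)) (toℕ-fromℕ< c<k))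

  arc-empty : ∀ i → arc i 0 ≡ origin
  arc-empty i = tabulate-cong λ c → dec-false (offset k i (toℕ c) <? 0) λ ()

  coordinateAt : ∀ {i x} → i < k → x < k → Σ (Fin k) λ d → offset k i (toℕ d) ≡ x
  coordinateAt i<k x<k with offset-surjective {k} i<k x<k
  ... | c , c<k , offset≡x = fromℕ< c<k , trans (cong (offset k _) (toℕ-fromℕ< c<k)) offset≡x

  -- Lengthening an arc by one flips exactly the coordinate at offset a.
  arc-step : ∀ {i a} → i < k → a < n → Adj (arc i a) (arc i (suc a))
  arc-step {i} {a} i<k a<n with coordinateAt i<k (m<n⇒m<1+n a<n)
  ... | d , offset≡a = adjacent-tabulate (onArc i a) (onArc i (suc a)) d agree differ
    where
    agree : ∀ c → c ≢ d → onArc i a c ≡ onArc i (suc a) c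
    agree c c≢d = does-<-suc λ offset≡a′ →
      c≢d (toℕ-injective (offset-injective i<k (toℕ<n c) (toℕ<n d) (trans offset≡a′ (sym offset≡a))))
    differ : onArc i a d ≢ onArc i (suc a) d
    differ eq = contradiction
      (begin
        false                ≡⟨ dec-false (a <? a) (<-irrefl refl) ⟨
        does (a <? a)        ≡⟨ cong (λ x → does (x <? a)) offset≡a ⟨
        onArc i a d          ≡⟨ eq ⟩
        onArc i (suc a) d    ≡⟨ cong (λ x → does (x <? suc a)) offset≡a ⟩
        does (a <? suc a)    ≡⟨ dec-true (a <? suc a) (n<1+n a) ⟩
        true                 ∎)
      λ ()

  -- Arcs from the same start with different lengths a < b differ at the
  -- coordinate of offset a.
  arc-injective< : ∀ {i a b} → i < k → a < b → b < k → arc i a ≢ arc i b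
  arc-injective< {i} {a} {b} i<k a<b b<k eq with coordinateAt i<k (<-trans a<b b<k)
  ... | d , offset≡a = contradiction
    (begin
      false               ≡⟨ dec-false (a <? a) (<-irrefl refl) ⟨
      does (a <? a)       ≡⟨ cong (λ x → does (x <? a)) offset≡a ⟨
      onArc i a d         ≡⟨ lookup∘tabulate (onArc i a) d ⟨
      lookup (arc i a) d  ≡⟨ cong (λ v → lookup v d) eq ⟩
      lookup (arc i b) d  ≡⟨ lookup∘tabulate (onArc i b) d ⟩
      onArc i b d         ≡⟨ cong (λ x → does (x <? b)) offset≡a ⟩
      does (a <? b)       ≡⟨ dec-true (a <? b) a<b ⟩
      true                ∎)
    λ ()

  arc-injective : ∀ {i a b} → i < k → a < k → b < k → arc i a ≡ arc i b → a ≡ b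
  arc-injective {i} {a} {b} i<k a<k b<k eq with <-cmp a b
  ... | tri< a<b _ _ = contradiction eq (arc-injective< i<k a<b b<k)
  ... | tri≈ _ a≡b _ = a≡b
  ... | tri> _ _ b<a = contradiction (sym eq) (arc-injective< i<k b<a a<k)

  -- Nonempty proper arcs with different starts differ: arc i (a + 1)
  -- contains i but not its predecessor p, while an arc from i′ ≠ i that
  -- contains i also contains p.
  arcs-disjoint : ∀ {i i′ a b} → i < k → i′ < k → i ≢ i′ → suc a < k →
                  arc i (suc a) ≢ arc i′ b
  arcs-disjoint {i} {i′} {a} {b} i<k i′<k i≢i′ a+1<k eq =
    contradiction (<-trans (n<1+n _) (subst (_< b) (before i′<k (i≢i′ ∘ sym)) i∈arc′)) p∉arc′
    where
    open Predecessor (predecessor n i i<k) renaming (position to p)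
    same-at : ∀ {c} (c<k : c < k) → does (offset k i c <? suc a) ≡ does (offset k i′ c <? b)
    same-at c<k = trans (sym (arc-at i (suc a) c<k))
                        (trans (cong (λ v → lookup v (fromℕ< c<k)) eq) (arc-at i′ b c<k))
    i∈arc′ : offset k i′ i < b
    i∈arc′ = does-true (offset k i′ i <? b)
      (trans (sym (same-at i<k))
             (dec-true (offset k i i <? suc a) (subst (_< suc a) (sym (offset-self i<k)) z<s)))
    p∉arc′ : ¬ offset k i′ p < b
    p∉arc′ p<b = <⇒≱ (s≤s⁻¹ a+1<k) (s≤s⁻¹ (subst (_< suc a) last p∈arc))
      where
      p∈arc : offset k i p < suc a
      p∈arc = does-true (offset k i p <? suc a)
                        (trans (same-at bounded) (dec-true (offset k i′ p <? b) p<b))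

  cyclicPath : Fin k → Path k n
  cyclicPath i = record
    { vtx      = λ a → arc (toℕ i) (toℕ a)
    ; adjacent = λ a → subst (λ t → Adj (arc (toℕ i) t) (arc (toℕ i) (suc (toℕ a))))
                             (sym (toℕ-inject₁ a)) (arc-step (toℕ<n i) (toℕ<n a))
    ; distinct = λ {a} {b} eq → toℕ-injective (arc-injective (toℕ<n i) (toℕ<n a) (toℕ<n b) eq)
    }

  cyclicPaths : DisjointPathsFrom k k n
  cyclicPaths = origin , cyclicPath , (λ i → arc-empty (toℕ i)) , meetOnlyAtOrigin
    where
    meetOnlyAtOrigin : (i i′ : Fin k) → i ≢ i′ → (a b : Fin k) →
                       vtx (cyclicPath i) a ≡ vtx (cyclicPath i′) b → vtx (cyclicPath i) a ≡ origin
    meetOnlyAtOrigin i _  _     zero    _ _  = arc-empty (toℕ i)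
    meetOnlyAtOrigin i i′ i≢i′ (suc a) b eq =
      contradiction eq (arcs-disjoint {b = toℕ b} (toℕ<n i) (toℕ<n i′)
                                      (i≢i′ ∘ toℕ-injective) (toℕ<n (suc a)))

disjointPaths-≤ : ∀ {k t t′ ℓ} → t′ ≤ t → DisjointPathsFrom k t ℓ → DisjointPathsFrom k t′ ℓ
disjointPaths-≤ {t = t} {t′} t′≤t (v , P , starts , disjoint) =
  v , P ∘ embed , starts ∘ embed ,
  λ i j i≢j → disjoint (embed i) (embed j) (i≢j ∘ inject≤-injective t′≤t t′≤t i j)
  where
  embed : Fin t′ → Fin t
  embed i = inject≤ i t′≤t

lemma6 : (k j : ℕ) → 1 ≤ k → 1 ≤ j → j ≤ k →
    Σ ℕ (λ ℓ → (k ∸ 1 ≤ ℓ) × DisjointPathsFrom k j ℓ)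
lemma6 zero    _ ()  _ _
lemma6 (suc n) _ _   _ j≤k = n , ≤-refl , disjointPaths-≤ j≤k (CyclicArcs.cyclicPaths n)
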